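{- Let $n$ be an odd positive integer and let $c:E(Q_n)\to\{0,1\}$ be the edge coloring that assigns to the edge $\{(x_1,\dots,x_i,\dots,x_n),(x_1,\dots,1-x_i,\dots,x_n)\}$ the color $\bigoplus_{j\ne i} x_j$ (the parity of the sum of all coordinates other than the $i$-th). Then the number of blocking antipodal pairs in $c$ is $2^{n-1}\left(1-O\!\left(\tfrac{1}{\sqrt n}\right)\right)$.
   Context: $Q_n$ is the hypercube graph on $\{0,1\}^n$ (edges between vertices differing in exactly one coordinate). For a vertex $u$, $\bar u$ is the vertex obtained by complementing all coordinates; there are $2^{n-1}$ unordered antipodal pairs $\{u,\bar u\}$. An antipodal geodesic is a path of length $n$ from $u$ to $\bar u$. The number of color changes of a path is the number of internal vertices whose two path-edges have different colors. An antipodal pair $\{u,\bar u\}$ is blocking (for a coloring) if every antipodal geodesic between $u$ and $\bar u$ has at least $2$ color changes. -}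

module Defs where

open import Data.Bool using (Bool; true; false; not; _xor_; if_then_else_)
open import Data.Nat using (ℕ; zero; suc; _+_; _≤_)
open import Data.Fin using (Fin; zero; suc; inject₁; fromℕ; _≟_)
open import Data.Vec using (Vec; lookup; map)
open import Data.List using (List; []; _∷_; foldr; tabulate)
open import Data.Product using (Σ; _×_)
open import Relation.Nullary using (¬_; does)
open import Relation.Binary.PropositionalEquality using (_≡_; _≢_)

Vertex : ℕ → Set
Vertex n = Vec Bool n

complement : ∀ {n} → Vertex n → Vertex n
complement = map not

AdjacentVia : ∀ {n} → Vertex n → Vertex n → Fin n → Set
AdjacentVia v w i = (lookup v i ≢ lookup w i) × (∀ j → j ≢ i → lookup v j ≡ lookup w j)

Adjacent : ∀ {n} → Vertex n → Vertex n → Set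
Adjacent {n} v w = Σ (Fin n) (AdjacentVia v w)

parityExcept : ∀ {n} → Vertex n → Fin n → Bool
parityExcept {n} x i =
  foldr _xor_ false (tabulate {n = n} (λ j → if does (j ≟ i) then false else lookup x j))

-- The coloring c of the statement: the edge {x, x with coordinate i flipped}
-- gets color ⊕_{j ≠ i} x_j (well defined, as both endpoints agree off i).
edgeColor : ∀ {n} (v w : Vertex n) → Adjacent v w → Bool
edgeColor v w (i Data.Product., _) = parityExcept v i

record Path (n L : ℕ) : Set where
  field
    vertex : Fin (suc L) → Vertex n
    step   : (k : Fin L) → Adjacent (vertex (inject₁ k)) (vertex (suc k))
open Path public

record AntipodalGeodesic {n : ℕ} (u : Vertex n) : Set where
  field
    path  : Path n n
    start : vertex path zero ≡ u
    end   : vertex path (fromℕ n) ≡ complement u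
open AntipodalGeodesic public

edgeColors : ∀ {n L} → Path n L → List Bool
edgeColors {L = L} p = tabulate {n = L} (λ k → edgeColor (vertex p (inject₁ k)) (vertex p (suc k)) (step p k))

changes : List Bool → ℕ
changes []           = 0
changes (a ∷ [])     = 0
changes (a ∷ b ∷ xs) = (if a xor b then 1 else 0) + changes (b ∷ xs)

colorChanges : ∀ {n L} → Path n L → ℕ
colorChanges p = changes (edgeColors p)

Blocking : ∀ {n} → Vertex n → Set
Blocking u = (g : AntipodalGeodesic u) → 2 ≤ colorChanges (path g)

module Submission where

-- Flipping coordinate i at x has color parity(x) ⊕ xᵢ, and the parity alternates along a
-- path, so two consecutive edges differ in color exactly when both steps go in the same
-- direction (both 1 → 0 or both 0 → 1). A path with at most one color change therefore
-- nearly alternates between the two directions, and an antipodal geodesic from u with at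
-- most one change forces |wt u − wt ū| ≤ 2; for n = 2k + 1 this means wt u ∈ {k, k + 1}.
-- Conversely, for such u, flipping the ones and the zeros of u alternately gives a geodesic
-- with no change at all. So the non-blocking pairs number C(2k, k) + C(2k, k + 1)
-- = C(2k + 1, k + 1) ≤ 2 C(2k, k), and C(2m, m)² (2m + 1) ≤ 16ᵐ follows by induction
-- from (m + 1) C(2m + 2, m + 1) = 2 (2m + 1) C(2m, m).

open import Defs
open import Data.Bool using (Bool; true; false; not; _xor_; if_then_else_)
open import Data.Bool.Properties
  using (¬-not; not-¬; not-involutive; not-distribˡ-xor; not-distribʳ-xor; xor-assoc; xor-comm; xor-inverseʳ)
open import Data.Empty using (⊥-elim)
open import Data.Fin using (Fin; zero; suc; inject₁; fromℕ)
import Data.Fin as Fin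
open import Data.List using (List; []; _∷_; foldr; tabulate; length; filter; _++_)
import Data.List as List
open import Data.List.Properties using (length-++; length-map; filter-++; filter-≐; filter-none)
open import Data.List.Membership.Propositional using (_∈_)
open import Data.List.Membership.Propositional.Properties
  using (∈-map⁺; ∈-map⁻; ∈-++⁺ˡ; ∈-++⁺ʳ; ∈-filter⁺; ∈-filter⁻)
import Data.List.Relation.Unary.All as All
import Data.List.Relation.Unary.AllPairs as AllPairs
open import Data.List.Relation.Unary.Any using (here)
open import Data.List.Relation.Unary.Unique.Propositional using (Unique)
open import Data.List.Relation.Unary.Unique.Propositional.Properties using (map⁺; ++⁺; filter⁺)
open import Data.Nat using (ℕ; zero; suc; _+_; _*_; _^_; _∸_; _≤_; _≤?_; _≟_; s≤s)
open import Data.Nat.Combinatorics using (_C_; nCk+nC[k+1]≡[n+1]C[k+1]; nCk≡nC[n∸k]; nC1≡n)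
open import Data.Nat.Properties
open import Data.Nat.Tactic.RingSolver using (solve-∀)
open import Data.Product using (Σ; ∃-syntax; _×_; _,_; proj₁; proj₂)
import Data.Product as Product
open import Data.Sum using (_⊎_; inj₁; inj₂; swap)
import Data.Sum as Sum
open import Data.Unit using (⊤; tt)
open import Data.Vec using ([]; _∷_; head; lookup; updateAt)
import Data.Vec as Vec
open import Data.Vec.Properties
  using (∷-injectiveʳ; lookup∘updateAt; lookup∘updateAt′; tabulate∘lookup; tabulate-cong)
open import Function using (_∘_; id)
open import Function.Bundles using (_⇔_; mk⇔)
open import Level using (0ℓ)
open import Relation.Binary.PropositionalEquality
open import Relation.Nullary using (¬_; yes; no)
open import Relation.Unary using (Pred; Decidable)
open import Relation.Unary.Properties using (∁?; _∪?_)

weight : ∀ {n} → Vertex n → ℕ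
weight []          = 0
weight (true  ∷ v) = suc (weight v)
weight (false ∷ v) = weight v

parity : ∀ {n} → Vertex n → Bool
parity []      = false
parity (b ∷ v) = b xor parity v

flip : ∀ {n} → Fin n → Vertex n → Vertex n
flip i v = updateAt v i not

lookup-flip : ∀ {n} (v : Vertex n) i → lookup (flip i v) i ≡ not (lookup v i)
lookup-flip v i = lookup∘updateAt i v

flip-adjacentVia : ∀ {n} (v : Vertex n) i → AdjacentVia v (flip i v) i
flip-adjacentVia v i =
  (λ eq → not-¬ refl (trans eq (lookup-flip v i))) ,
  (λ j j≢i → sym (lookup∘updateAt′ j i j≢i v))

adjacentVia⇒≡flip : ∀ {n} {v w : Vertex n} {i} → AdjacentVia v w i → w ≡ flip i v
adjacentVia⇒≡flip {v = v} {w} {i} (vᵢ≢wᵢ , same) = begin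
  w                                ≡⟨ tabulate∘lookup w ⟨
  Vec.tabulate (lookup w)          ≡⟨ tabulate-cong pointwise ⟩
  Vec.tabulate (lookup (flip i v)) ≡⟨ tabulate∘lookup (flip i v) ⟩
  flip i v                         ∎
  where
  open ≡-Reasoning
  pointwise : ∀ j → lookup w j ≡ lookup (flip i v) j
  pointwise j with j Fin.≟ i
  ... | yes refl = trans (¬-not (vᵢ≢wᵢ ∘ sym)) (sym (lookup-flip v i))
  ... | no  j≢i  = trans (sym (same j j≢i)) (sym (lookup∘updateAt′ j i j≢i v))

parity-flip : ∀ {n} (v : Vertex n) i → parity (flip i v) ≡ not (parity v)
parity-flip (b ∷ v) zero    = sym (not-distribˡ-xor b (parity v))
parity-flip (b ∷ v) (suc i) = trans (cong (b xor_) (parity-flip v i)) (sym (not-distribʳ-xor b (parity v)))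

WeightStep : Bool → ℕ → ℕ → Set
WeightStep true  w w′ = w ≡ suc w′
WeightStep false w w′ = w′ ≡ suc w

weight-flip : ∀ {n} (v : Vertex n) i → WeightStep (lookup v i) (weight v) (weight (flip i v))
weight-flip (true  ∷ v) zero    = refl
weight-flip (false ∷ v) zero    = refl
weight-flip (true  ∷ v) (suc i) = suc-weightStep (lookup v i) (weight-flip v i)
  where
  suc-weightStep : ∀ b {w w′} → WeightStep b w w′ → WeightStep b (suc w) (suc w′)
  suc-weightStep true  = cong suc
  suc-weightStep false = cong suc
weight-flip (false ∷ v) (suc i) = weight-flip v i

foldr-xor-tabulate-lookup : ∀ {n} (v : Vertex n) → foldr _xor_ false (tabulate (lookup v)) ≡ parity v
foldr-xor-tabulate-lookup []      = refl
foldr-xor-tabulate-lookup (b ∷ v) = cong (b xor_) (foldr-xor-tabulate-lookup v)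

parityExcept≡parity-xor-lookup : ∀ {n} (v : Vertex n) i → parityExcept v i ≡ parity v xor lookup v i
parityExcept≡parity-xor-lookup (b ∷ v) zero    = trans (foldr-xor-tabulate-lookup v) (sym (cancel b))
  where
  cancel : ∀ b → (b xor parity v) xor b ≡ parity v
  cancel true  = trans (xor-comm (not (parity v)) true) (not-involutive (parity v))
  cancel false = xor-comm (parity v) false
parityExcept≡parity-xor-lookup (b ∷ v) (suc i) =
  trans (cong (b xor_) (parityExcept≡parity-xor-lookup v i)) (sym (xor-assoc b (parity v) (lookup v i)))

color-change≡same-direction : ∀ {n} {x y : Vertex n} {i} j → AdjacentVia x y i →
  parityExcept x i xor parityExcept y j ≡ not (lookup x i xor lookup y j)
color-change≡same-direction {x = x} {y} {i} j adj = begin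
  parityExcept x i xor parityExcept y j
    ≡⟨ cong₂ _xor_ (parityExcept≡parity-xor-lookup x i) (parityExcept≡parity-xor-lookup y j) ⟩
  (parity x xor lookup x i) xor (parity y xor lookup y j)
    ≡⟨ cong (λ p → (parity x xor lookup x i) xor (p xor lookup y j)) parity-y ⟩
  (parity x xor lookup x i) xor (not (parity x) xor lookup y j)
    ≡⟨ opposite-parities (parity x) ⟩
  not (lookup x i xor lookup y j) ∎
  where
  open ≡-Reasoning
  parity-y : parity y ≡ not (parity x)
  parity-y = trans (cong parity (adjacentVia⇒≡flip {v = x} {y} adj)) (parity-flip x i)
  opposite-parities : ∀ p → (p xor lookup x i) xor (not p xor lookup y j) ≡ not (lookup x i xor lookup y j)
  opposite-parities true  = sym (not-distribˡ-xor (lookup x i) (lookup y j))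
  opposite-parities false = sym (not-distribʳ-xor (lookup x i) (lookup y j))

-- The bit a step flips: true for a step 1 → 0, which lowers the weight.
direction : ∀ {n L} → Path n L → Fin L → Bool
direction p k = lookup (vertex p (inject₁ k)) (proj₁ (step p k))

weight-along : ∀ {n L} (p : Path n L) k →
  WeightStep (direction p k) (weight (vertex p (inject₁ k))) (weight (vertex p (suc k)))
weight-along p k =
  subst (WeightStep (direction p k) (weight (vertex p (inject₁ k))) ∘ weight)
    (sym (adjacentVia⇒≡flip {v = vertex p (inject₁ k)} {vertex p (suc k)} (proj₂ (step p k))))
    (weight-flip (vertex p (inject₁ k)) (proj₁ (step p k)))

tail : ∀ {n L} → Path n (suc L) → Path n L
vertex (tail p) k = vertex p (suc k)
step   (tail p) k = step p (suc k)

-- End weights w, w′ of a path with e color changes whose first step has direction b: between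
-- changes the directions alternate, so each of the e + 1 alternating runs moves the weight by
-- at most one.
Drift : Bool → ℕ → ℕ → ℕ → Set
Drift true  e w w′ = w′ ≤ w + e × w ≤ w′ + suc e
Drift false e w w′ = w′ ≤ w + suc e × w ≤ w′ + e

drift-single : ∀ b {w w′} → WeightStep b w w′ → Drift b 0 w w′
drift-single true  {w′ = w′} refl = m≤n⇒m≤n+o 0 (n≤1+n w′) , ≤-reflexive (+-comm 1 w′)
drift-single false {w = w}   refl = ≤-reflexive (+-comm 1 w) , m≤n⇒m≤n+o 0 (n≤1+n w)

drift-∷ : ∀ b b₁ {e w w₁ w′} → WeightStep b w w₁ → Drift b₁ e w₁ w′ →
  Drift b ((if not (b xor b₁) then 1 else 0) + e) w w′
drift-∷ true  true  {e} {w₁ = w₁} {w′} refl (up , down) =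
  ≤-trans up (+-mono-≤ (n≤1+n w₁) (n≤1+n e)) ,
  subst (suc w₁ ≤_) (sym (+-suc w′ (suc e))) (s≤s down)
drift-∷ true  false {e} {w₁ = w₁} {w′} refl (up , down) =
  subst (w′ ≤_) (+-suc w₁ e) up ,
  subst (suc w₁ ≤_) (sym (+-suc w′ e)) (s≤s down)
drift-∷ false true  {e} {w} {w′ = w′} refl (up , down) =
  subst (w′ ≤_) (sym (+-suc w e)) up ,
  ≤-pred (subst (suc w ≤_) (+-suc w′ e) down)
drift-∷ false false {e} {w} {w′ = w′} refl (up , down) =
  subst (w′ ≤_) (sym (+-suc w (suc e))) up ,
  ≤-trans (n≤1+n w) (≤-trans down (+-monoʳ-≤ w′ (n≤1+n e)))

drift : ∀ {n} L (p : Path n (suc L)) →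
  Drift (direction p zero) (colorChanges p) (weight (vertex p zero)) (weight (vertex p (fromℕ (suc L))))
drift zero    p = drift-single _ (weight-along p zero)
drift (suc L) p =
  subst (λ c → Drift (direction p zero) ((if c then 1 else 0) + colorChanges (tail p)) first last)
    (sym (color-change≡same-direction {x = vertex p zero} {vertex p (suc zero)} _ (proj₂ (step p zero))))
    (drift-∷ _ _ (weight-along p zero) (drift L (tail p)))
  where
  first = weight (vertex p zero)
  last  = weight (vertex p (fromℕ (suc (suc L))))

drift-weaken : ∀ b {e w w′} → Drift b e w w′ → w′ ≤ w + suc e × w ≤ w′ + suc e
drift-weaken true  {e} {w}       (up , down) = ≤-trans up (+-monoʳ-≤ w (n≤1+n e)) , down
drift-weaken false {e} {w′ = w′} (up , down) = up , ≤-trans down (+-monoʳ-≤ w′ (n≤1+n e))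

Balanced : ℕ → ℕ → Set
Balanced k w = w ≡ k ⊎ w ≡ suc k

close⇒balanced : ∀ {k w w̄} → w + w̄ ≡ suc (2 * k) → w̄ ≤ w + 2 → w ≤ w̄ + 2 → Balanced k w
close⇒balanced {k} {w} {w̄} sum w̄≤w+2 w≤w̄+2 =
  swap (Sum.map (≤-antisym w≤1+k) sym (m≤n⇒m<n∨m≡n k≤w))
  where
  open ≤-Reasoning
  k≤w : k ≤ w
  k≤w = ≤-pred (*-cancelˡ-< 2 k (suc w) (begin-strict
    2 * k       <⟨ n<1+n (2 * k) ⟩
    suc (2 * k) ≡⟨ sum ⟨
    w + w̄       ≤⟨ +-monoʳ-≤ w w̄≤w+2 ⟩
    w + (w + 2) ≡⟨ double w ⟩
    2 * suc w   ∎))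
    where
    double : ∀ w → w + (w + 2) ≡ 2 * suc w
    double = solve-∀
  w≤1+k : w ≤ suc k
  w≤1+k = ≤-pred (*-cancelˡ-< 2 w (suc (suc k)) (begin-strict
    2 * w           ≡⟨ cong (w +_) (+-identityʳ w) ⟩
    w + w           ≤⟨ +-monoʳ-≤ w w≤w̄+2 ⟩
    w + (w̄ + 2)     ≡⟨ +-assoc w w̄ 2 ⟨
    w + w̄ + 2       ≡⟨ cong (_+ 2) sum ⟩
    suc (2 * k) + 2 <⟨ ≤-reflexive (odd+3 k) ⟩
    2 * suc (suc k) ∎))
    where
    odd+3 : ∀ k → suc (suc (2 * k) + 2) ≡ 2 * suc (suc k)
    odd+3 = solve-∀

balanced⇒differ-by-one : ∀ {k w w̄} → w + w̄ ≡ suc (2 * k) → Balanced k w → w̄ ≡ suc w ⊎ w ≡ suc w̄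
balanced⇒differ-by-one {k} {w̄ = w̄} sum (inj₁ refl) =
  inj₁ (+-cancelˡ-≡ k w̄ (suc k) (trans sum (odd k)))
  where
  odd : ∀ k → suc (2 * k) ≡ k + suc k
  odd = solve-∀
balanced⇒differ-by-one {k} {w̄ = w̄} sum (inj₂ refl) =
  inj₂ (cong suc (sym (+-cancelˡ-≡ k w̄ k (trans (suc-injective sum) (cong (k +_) (+-identityʳ k))))))

weight+weight-complement : ∀ {n} (u : Vertex n) → weight u + weight (complement u) ≡ n
weight+weight-complement []          = refl
weight+weight-complement (true  ∷ u) = cong suc (weight+weight-complement u)
weight+weight-complement (false ∷ u) = trans (+-suc _ _) (cong suc (weight+weight-complement u))

few-changes⇒balanced : ∀ {k} {u : Vertex (suc (2 * k))} (g : AntipodalGeodesic u) →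
  colorChanges (path g) ≤ 1 → Balanced k (weight u)
few-changes⇒balanced {k} {u} g changes≤1 =
  close⇒balanced (weight+weight-complement u)
    (≤-trans ū≤ (+-monoʳ-≤ (weight u) (s≤s changes≤1)))
    (≤-trans u≤ (+-monoʳ-≤ (weight (complement u)) (s≤s changes≤1)))
  where
  e = colorChanges (path g)
  bounds = drift-weaken _ (drift (2 * k) (path g))
  ū≤ : weight (complement u) ≤ weight u + suc e
  ū≤ = subst₂ (λ x y → weight y ≤ weight x + suc e) (start g) (end g) (proj₁ bounds)
  u≤ : weight u ≤ weight (complement u) + suc e
  u≤ = subst₂ (λ x y → weight x ≤ weight y + suc e) (start g) (end g) (proj₂ bounds)

¬balanced⇒blocking : ∀ {k} {u : Vertex (suc (2 * k))} → ¬ Balanced k (weight u) → Blocking u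
¬balanced⇒blocking ¬balanced g with 2 ≤? colorChanges (path g)
... | yes 2≤changes = 2≤changes
... | no  2≰changes = ⊥-elim (¬balanced (few-changes⇒balanced g (≤-pred (≰⇒> 2≰changes))))

-- mismatches b x y counts the coordinates that a geodesic from x to y flips from b to not b.
mismatch : Bool → Bool → Bool → ℕ
mismatch true  true  false = 1
mismatch false false true  = 1
mismatch _     _     _     = 0

mismatches : ∀ {n} → Bool → Vertex n → Vertex n → ℕ
mismatches b []      []      = 0
mismatches b (a ∷ x) (c ∷ y) = mismatch b a c + mismatches b x y

mismatches-complement : ∀ {n} (u : Vertex n) →
  mismatches true u (complement u) ≡ weight u × mismatches false u (complement u) ≡ weight (complement u)
mismatches-complement []          = refl , refl
mismatches-complement (true  ∷ u) = Product.map (cong suc) id (mismatches-complement u)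
mismatches-complement (false ∷ u) = Product.map id (cong suc) (mismatches-complement u)

mismatches≡0⇒≡ : ∀ {n} (x y : Vertex n) → mismatches true x y ≡ 0 → mismatches false x y ≡ 0 → x ≡ y
mismatches≡0⇒≡ []          []          _  _  = refl
mismatches≡0⇒≡ (true  ∷ x) (true  ∷ y) e  e′ = cong (true ∷_) (mismatches≡0⇒≡ x y e e′)
mismatches≡0⇒≡ (false ∷ x) (false ∷ y) e  e′ = cong (false ∷_) (mismatches≡0⇒≡ x y e e′)
mismatches≡0⇒≡ (true  ∷ x) (false ∷ y) () _
mismatches≡0⇒≡ (false ∷ x) (true  ∷ y) _  ()

FlipTowards : ∀ {n} → Bool → Vertex n → Vertex n → ℕ → Set
FlipTowards {n} b x y m = Σ (Fin n) λ j →
  lookup x j ≡ b × mismatches b (flip j x) y ≡ m × mismatches (not b) (flip j x) y ≡ mismatches (not b) x y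

flipTowards-∷ : ∀ {n b a c m} {x y : Vertex n} → mismatch b a c ≡ 0 →
  FlipTowards b x y m → FlipTowards b (a ∷ x) (c ∷ y) m
flipTowards-∷ {b = b} {a} {c} matched (j , xⱼ , same , other) =
  suc j , xⱼ , trans (cong (_+ _) matched) same , cong (mismatch (not b) a c +_) other

flipTowards : ∀ {n m} b (x y : Vertex n) → mismatches b x y ≡ suc m → FlipTowards b x y m
flipTowards b     []          []          ()
flipTowards true  (true  ∷ x) (false ∷ y) eq = zero , refl , suc-injective eq , refl
flipTowards true  (true  ∷ x) (true  ∷ y) eq = flipTowards-∷ refl (flipTowards true x y eq)
flipTowards true  (false ∷ x) (c     ∷ y) eq = flipTowards-∷ refl (flipTowards true x y eq)
flipTowards false (false ∷ x) (true  ∷ y) eq = zero , refl , suc-injective eq , refl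
flipTowards false (false ∷ x) (false ∷ y) eq = flipTowards-∷ refl (flipTowards false x y eq)
flipTowards false (true  ∷ x) (c     ∷ y) eq = flipTowards-∷ refl (flipTowards false x y eq)

stay : ∀ {n} → Vertex n → Path n 0
vertex (stay x) _ = x
step   (stay x) ()

prepend : ∀ {n L} (x : Vertex n) (p : Path n L) → Adjacent x (vertex p zero) → Path n (suc L)
vertex (prepend x p s) zero    = x
vertex (prepend x p s) (suc k) = vertex p k
step   (prepend x p s) zero    = s
step   (prepend x p s) (suc k) = step p k

StartsIn : ∀ {n L} → Bool → Path n L → Set
StartsIn {L = zero}  b p = ⊤
StartsIn {L = suc L} b p = direction p zero ≡ b

colorChanges-prepend : ∀ {n L} (x : Vertex n) (p : Path n L) {j} (adj : AdjacentVia x (vertex p zero) j) →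
  StartsIn (not (lookup x j)) p → colorChanges (prepend x p (j , adj)) ≡ colorChanges p
colorChanges-prepend {L = zero}  x p adj _ = refl
colorChanges-prepend {L = suc L} x p {j} adj turns =
  cong (λ c → (if c then 1 else 0) + colorChanges p) (begin
    _                                     ≡⟨ color-change≡same-direction {x = x} {vertex p zero} _ adj ⟩
    not (lookup x j xor direction p zero) ≡⟨ cong (λ d → not (lookup x j xor d)) turns ⟩
    not (lookup x j xor not (lookup x j)) ≡⟨ cong not (xor-inverseʳ (lookup x j)) ⟩
    false                                 ∎)
  where open ≡-Reasoning

Zigzag : ∀ {n} L → Bool → Vertex n → Vertex n → Set
Zigzag {n} L b x y = Σ (Path n L) λ p →
  vertex p zero ≡ x × vertex p (fromℕ L) ≡ y × StartsIn b p × colorChanges p ≡ 0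

zigzag-prepend : ∀ {n L b} {x y : Vertex n} j → lookup x j ≡ b →
  Zigzag L (not b) (flip j x) y → Zigzag (suc L) b x y
zigzag-prepend {x = x} j xⱼ (p , start , end , starts , unchanged) =
  prepend x p (j , adj) , refl , end , xⱼ ,
  trans (colorChanges-prepend x p adj (subst (λ c → StartsIn (not c) p) (sym xⱼ) starts)) unchanged
  where
  adj : AdjacentVia x (vertex p zero) j
  adj = subst (λ z → AdjacentVia x z j) (sym start) (flip-adjacentVia x j)

-- T steps in direction b and F in the other alternate, starting with b, iff T ∈ {F, F + 1}.
zigzag : ∀ {n} L b (x y : Vertex n) {T F} → mismatches b x y ≡ T → mismatches (not b) x y ≡ F →
  Balanced F T → T + F ≡ L → Zigzag L b x y
zigzag zero    true  x y {zero}  {zero}  eT eF _ _ = stay x , refl , mismatches≡0⇒≡ x y eT eF , tt , refl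
zigzag zero    false x y {zero}  {zero}  eT eF _ _ = stay x , refl , mismatches≡0⇒≡ x y eF eT , tt , refl
zigzag zero    b     x y {zero}  {suc F} _  _  _ ()
zigzag zero    b     x y {suc T}         _  _  _ ()
zigzag (suc L) b     x y {zero}          _  _  (inj₁ refl) ()
zigzag (suc L) b     x y {suc m} {F}     eT eF balanced sum
  with j , xⱼ , same , other ← flipTowards b x y eT =
  zigzag-prepend j xⱼ
    (zigzag L (not b) (flip j x) y (trans other eF)
      (trans (cong (λ c → mismatches c (flip j x) y) (not-involutive b)) same)
      (alternate balanced) (trans (+-comm F m) (suc-injective sum)))
  where
  alternate : Balanced F (suc m) → Balanced m F
  alternate (inj₁ 1+m≡F) = inj₂ (sym 1+m≡F)
  alternate (inj₂ m≡F)   = inj₁ (sym (suc-injective m≡F))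

zigzag⇒¬blocking : ∀ {n b} {u : Vertex n} → Zigzag n b u (complement u) → ¬ Blocking u
zigzag⇒¬blocking (p , start , end , _ , unchanged) blocking
  with () ← subst (2 ≤_) unchanged (blocking record { path = p ; start = start ; end = end })

differ-by-one⇒¬blocking : ∀ {n} (u : Vertex n) →
  weight (complement u) ≡ suc (weight u) ⊎ weight u ≡ suc (weight (complement u)) → ¬ Blocking u
differ-by-one⇒¬blocking {n} u (inj₁ ū≡1+u) = zigzag⇒¬blocking
  (zigzag n false u (complement u) (proj₂ (mismatches-complement u)) (proj₁ (mismatches-complement u))
    (inj₂ ū≡1+u) (trans (+-comm _ (weight u)) (weight+weight-complement u)))
differ-by-one⇒¬blocking {n} u (inj₂ u≡1+ū) = zigzag⇒¬blocking
  (zigzag n true u (complement u) (proj₁ (mismatches-complement u)) (proj₂ (mismatches-complement u))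
    (inj₂ u≡1+ū) (weight+weight-complement u))

balanced⇒¬blocking : ∀ {k} {u : Vertex (suc (2 * k))} → Balanced k (weight u) → ¬ Blocking u
balanced⇒¬blocking {u = u} balanced =
  differ-by-one⇒¬blocking u (balanced⇒differ-by-one (weight+weight-complement u) balanced)

module _ {A : Set} {P : Pred A 0ℓ} (P? : Decidable P) where

  length-filter-map : ∀ {B : Set} (f : B → A) xs →
    length (filter P? (List.map f xs)) ≡ length (filter (P? ∘ f) xs)
  length-filter-map f []       = refl
  length-filter-map f (x ∷ xs) with P? (f x)
  ... | yes _ = cong suc (length-filter-map f xs)
  ... | no  _ = length-filter-map f xs

  length-filter+length-filter-∁ : ∀ xs → length (filter P? xs) + length (filter (∁? P?) xs) ≡ length xs
  length-filter+length-filter-∁ []       = refl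
  length-filter+length-filter-∁ (x ∷ xs) with P? x
  ... | yes _ = cong suc (length-filter+length-filter-∁ xs)
  ... | no  _ = trans (+-suc _ _) (cong suc (length-filter+length-filter-∁ xs))

  length-filter-∪ : ∀ {Q : Pred A 0ℓ} (Q? : Decidable Q) → (∀ {x} → P x → ¬ Q x) → ∀ xs →
    length (filter (P? ∪? Q?) xs) ≡ length (filter P? xs) + length (filter Q? xs)
  length-filter-∪ Q? disjoint []       = refl
  length-filter-∪ Q? disjoint (x ∷ xs) with P? x | Q? x
  ... | yes p | yes q = ⊥-elim (disjoint p q)
  ... | yes _ | no  _ = cong suc (length-filter-∪ Q? disjoint xs)
  ... | no  _ | yes _ = trans (cong suc (length-filter-∪ Q? disjoint xs)) (sym (+-suc _ _))
  ... | no  _ | no  _ = length-filter-∪ Q? disjoint xs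

vertices : ∀ m → List (Vertex m)
vertices zero    = [] ∷ []
vertices (suc m) = List.map (false ∷_) (vertices m) ++ List.map (true ∷_) (vertices m)

∈-vertices : ∀ {m} (v : Vertex m) → v ∈ vertices m
∈-vertices []                  = here refl
∈-vertices         (false ∷ v) = ∈-++⁺ˡ (∈-map⁺ (false ∷_) (∈-vertices v))
∈-vertices {suc m} (true  ∷ v) = ∈-++⁺ʳ (List.map (false ∷_) (vertices m)) (∈-map⁺ (true ∷_) (∈-vertices v))

vertices-unique : ∀ m → Unique (vertices m)
vertices-unique zero    = All.[] AllPairs.∷ AllPairs.[]
vertices-unique (suc m) =
  ++⁺ (map⁺ ∷-injectiveʳ (vertices-unique m)) (map⁺ ∷-injectiveʳ (vertices-unique m)) disjoint
  where
  disjoint : ∀ {v} → ¬ (v ∈ List.map (false ∷_) (vertices m) × v ∈ List.map (true ∷_) (vertices m))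
  disjoint (v∈falses , v∈trues) with ∈-map⁻ (false ∷_) v∈falses | ∈-map⁻ (true ∷_) v∈trues
  ... | _ , _ , refl | _ , _ , ()

length-vertices : ∀ m → length (vertices m) ≡ 2 ^ m
length-vertices zero    = refl
length-vertices (suc m) = begin
  length (List.map (false ∷_) (vertices m) ++ List.map (true ∷_) (vertices m))
    ≡⟨ length-++ (List.map (false ∷_) (vertices m)) ⟩
  length (List.map (false ∷_) (vertices m)) + length (List.map (true ∷_) (vertices m))
    ≡⟨ cong₂ _+_ (length-map (false ∷_) (vertices m)) (length-map (true ∷_) (vertices m)) ⟩
  length (vertices m) + length (vertices m)
    ≡⟨ cong (λ l → l + l) (length-vertices m) ⟩
  2 ^ m + 2 ^ m
    ≡⟨ cong (2 ^ m +_) (+-identityʳ (2 ^ m)) ⟨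
  2 ^ suc m ∎
  where open ≡-Reasoning

weightIs? : ∀ {m} w → Decidable (λ (v : Vertex m) → weight v ≡ w)
weightIs? w v = weight v ≟ w

length-filter-weightIs : ∀ m w → length (filter (weightIs? w) (vertices m)) ≡ m C w
length-filter-weightIs zero    zero    = refl
length-filter-weightIs zero    (suc w) = refl
length-filter-weightIs (suc m) w       = begin
  length (filter (weightIs? w) (List.map (false ∷_) V ++ List.map (true ∷_) V))
    ≡⟨ cong length (filter-++ (weightIs? w) (List.map (false ∷_) V) _) ⟩
  length (filter (weightIs? w) (List.map (false ∷_) V) ++ filter (weightIs? w) (List.map (true ∷_) V))
    ≡⟨ length-++ (filter (weightIs? w) (List.map (false ∷_) V)) ⟩
  length (filter (weightIs? w) (List.map (false ∷_) V)) + length (filter (weightIs? w) (List.map (true ∷_) V))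
    ≡⟨ cong₂ _+_ (length-filter-map (weightIs? w) (false ∷_) V) (length-filter-map (weightIs? w) (true ∷_) V) ⟩
  length (filter (weightIs? w) V) + length (filter (λ v → suc (weight v) ≟ w) V)
    ≡⟨ cong (_+ length (filter (λ v → suc (weight v) ≟ w) V)) (length-filter-weightIs m w) ⟩
  m C w + length (filter (λ v → suc (weight v) ≟ w) V)
    ≡⟨ pascal w ⟩
  suc m C w ∎
  where
  open ≡-Reasoning
  V = vertices m
  pascal : ∀ w → m C w + length (filter (λ v → suc (weight v) ≟ w) V) ≡ suc m C w
  pascal zero    = cong (λ vs → 1 + length vs) (filter-none (λ v → suc (weight v) ≟ 0) (All.universal (λ _ ()) V))
  pascal (suc w) = begin
    m C suc w + length (filter (λ v → suc (weight v) ≟ suc w) V)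
      ≡⟨ cong (λ vs → m C suc w + length vs) (filter-≐ _ (weightIs? w) (suc-injective , cong suc) V) ⟩
    m C suc w + length (filter (weightIs? w) V)
      ≡⟨ cong (m C suc w +_) (length-filter-weightIs m w) ⟩
    m C suc w + m C w
      ≡⟨ +-comm (m C suc w) (m C w) ⟩
    m C w + m C suc w
      ≡⟨ nCk+nC[k+1]≡[n+1]C[k+1] m w ⟩
    suc m C suc w ∎

balanced? : ∀ {m} k → Decidable (λ (v : Vertex m) → Balanced k (weight v))
balanced? k = weightIs? k ∪? weightIs? (suc k)

length-filter-balanced : ∀ k → length (filter (balanced? k) (vertices (2 * k))) ≡ suc (2 * k) C suc k
length-filter-balanced k = begin
  length (filter (balanced? k) (vertices (2 * k)))
    ≡⟨ length-filter-∪ (weightIs? k) (weightIs? (suc k)) (λ w≡k w≡1+k → 1+n≢n (trans (sym w≡1+k) w≡k)) (vertices (2 * k)) ⟩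
  length (filter (weightIs? k) (vertices (2 * k))) + length (filter (weightIs? (suc k)) (vertices (2 * k)))
    ≡⟨ cong₂ _+_ (length-filter-weightIs (2 * k) k) (length-filter-weightIs (2 * k) (suc k)) ⟩
  2 * k C k + 2 * k C suc k
    ≡⟨ nCk+nC[k+1]≡[n+1]C[k+1] (2 * k) k ⟩
  suc (2 * k) C suc k ∎
  where open ≡-Reasoning

[k+1]*[n+1]C[k+1]≡[n+1]*nCk : ∀ n k → suc k * (suc n C suc k) ≡ suc n * (n C k)
[k+1]*[n+1]C[k+1]≡[n+1]*nCk zero    zero    = refl
[k+1]*[n+1]C[k+1]≡[n+1]*nCk zero    (suc k) = *-zeroʳ (suc (suc k))
[k+1]*[n+1]C[k+1]≡[n+1]*nCk (suc n) zero    =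
  trans (*-identityˡ (suc (suc n) C 1)) (trans (nC1≡n (suc (suc n))) (sym (*-identityʳ (suc (suc n)))))
[k+1]*[n+1]C[k+1]≡[n+1]*nCk (suc n) (suc k) = begin
  suc (suc k) * (suc (suc n) C suc (suc k))
    ≡⟨ cong (suc (suc k) *_) (nCk+nC[k+1]≡[n+1]C[k+1] (suc n) (suc k)) ⟨
  suc (suc k) * (suc n C suc k + suc n C suc (suc k))
    ≡⟨ regroup (suc n C suc k) (suc n C suc (suc k)) ⟩
  suc n C suc k + (suc k * (suc n C suc k) + suc (suc k) * (suc n C suc (suc k)))
    ≡⟨ cong (suc n C suc k +_)
         (cong₂ _+_ ([k+1]*[n+1]C[k+1]≡[n+1]*nCk n k) ([k+1]*[n+1]C[k+1]≡[n+1]*nCk n (suc k))) ⟩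
  suc n C suc k + (suc n * (n C k) + suc n * (n C suc k))
    ≡⟨ cong (suc n C suc k +_) (*-distribˡ-+ (suc n) (n C k) (n C suc k)) ⟨
  suc n C suc k + suc n * (n C k + n C suc k)
    ≡⟨ cong (λ s → suc n C suc k + suc n * s) (nCk+nC[k+1]≡[n+1]C[k+1] n k) ⟩
  suc (suc n) * (suc n C suc k) ∎
  where
  open ≡-Reasoning
  regroup : ∀ a b → suc (suc k) * (a + b) ≡ a + (suc k * a + suc (suc k) * b)
  regroup = solve-∀

[2m+2]C[m+1]≡2*[2m+1]C[m+1] : ∀ m → 2 * suc m C suc m ≡ 2 * (suc (2 * m) C suc m)
[2m+2]C[m+1]≡2*[2m+1]C[m+1] m = begin
  2 * suc m C suc m                         ≡⟨ cong (_C suc m) (*-suc 2 m) ⟩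
  suc (suc (2 * m)) C suc m                 ≡⟨ nCk+nC[k+1]≡[n+1]C[k+1] (suc (2 * m)) m ⟨
  suc (2 * m) C m + suc (2 * m) C suc m     ≡⟨ cong (_+ suc (2 * m) C suc m) symmetric ⟩
  suc (2 * m) C suc m + suc (2 * m) C suc m ≡⟨ cong (suc (2 * m) C suc m +_) (+-identityʳ _) ⟨
  2 * (suc (2 * m) C suc m)                 ∎
  where
  open ≡-Reasoning
  odd : ∀ m → suc (2 * m) ≡ m + suc m
  odd = solve-∀
  symmetric : suc (2 * m) C m ≡ suc (2 * m) C suc m
  symmetric = begin
    suc (2 * m) C m                 ≡⟨ nCk≡nC[n∸k] (≤-trans (m≤m+n m (m + 0)) (n≤1+n (2 * m))) ⟩
    suc (2 * m) C (suc (2 * m) ∸ m) ≡⟨ cong (λ n → suc (2 * m) C (n ∸ m)) (odd m) ⟩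
    suc (2 * m) C (m + suc m ∸ m)   ≡⟨ cong (suc (2 * m) C_) (m+n∸m≡n m (suc m)) ⟩
    suc (2 * m) C suc m             ∎

central-binomial-bound : ∀ m → (2 * m C m) ^ 2 * suc (2 * m) ≤ 16 ^ m
central-binomial-bound zero    = ≤-refl
central-binomial-bound (suc m) = *-cancelˡ-≤ (suc m * suc m) (begin
  suc m * suc m * ((2 * suc m C suc m) ^ 2 * suc (2 * suc m))
    ≡⟨ cong (λ x → suc m * suc m * (x ^ 2 * suc (2 * suc m))) ([2m+2]C[m+1]≡2*[2m+1]C[m+1] m) ⟩
  suc m * suc m * ((2 * d) ^ 2 * suc (2 * suc m))
    ≡⟨ regroup (suc m) d (suc (2 * suc m)) ⟩
  4 * suc (2 * suc m) * (suc m * d) ^ 2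
    ≡⟨ cong (λ x → 4 * suc (2 * suc m) * x ^ 2) ([k+1]*[n+1]C[k+1]≡[n+1]*nCk (2 * m) m) ⟩
  4 * suc (2 * suc m) * (suc (2 * m) * c) ^ 2
    ≡⟨ regroup′ (suc (2 * suc m)) (suc (2 * m)) c ⟩
  4 * suc (2 * suc m) * suc (2 * m) * (c ^ 2 * suc (2 * m))
    ≤⟨ *-monoʳ-≤ (4 * suc (2 * suc m) * suc (2 * m)) (central-binomial-bound m) ⟩
  4 * suc (2 * suc m) * suc (2 * m) * 16 ^ m
    ≤⟨ *-monoˡ-≤ (16 ^ m) (m≤m+n (4 * suc (2 * suc m) * suc (2 * m)) 4) ⟩
  (4 * suc (2 * suc m) * suc (2 * m) + 4) * 16 ^ m
    ≡⟨ cong (_* 16 ^ m) (square m) ⟩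
  suc m * suc m * 16 * 16 ^ m
    ≡⟨ *-assoc (suc m * suc m) 16 (16 ^ m) ⟩
  suc m * suc m * 16 ^ suc m ∎)
  where
  open ≤-Reasoning
  c = 2 * m C m
  d = suc (2 * m) C suc m
  regroup : ∀ a x s → a * a * ((2 * x) * ((2 * x) * 1) * s) ≡ 4 * s * ((a * x) * ((a * x) * 1))
  regroup = solve-∀
  regroup′ : ∀ s t x → 4 * s * ((t * x) * ((t * x) * 1)) ≡ 4 * s * t * (x * (x * 1) * t)
  regroup′ = solve-∀
  square : ∀ m → 4 * suc (2 * suc m) * suc (2 * m) + 4 ≡ suc m * suc m * 16
  square = solve-∀

16^k≡[2^[2k]]^2 : ∀ k → 16 ^ k ≡ (2 ^ (2 * k)) ^ 2
16^k≡[2^[2k]]^2 k = begin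
  16 ^ k            ≡⟨ ^-*-assoc 2 4 k ⟩
  2 ^ (4 * k)       ≡⟨ cong (2 ^_) (four k) ⟩
  2 ^ (2 * k * 2)   ≡⟨ ^-*-assoc 2 (2 * k) 2 ⟨
  (2 ^ (2 * k)) ^ 2 ∎
  where
  open ≡-Reasoning
  four : ∀ k → 4 * k ≡ 2 * k * 2
  four = solve-∀

[2k+1]C[k+1]-bound : ∀ k → (suc (2 * k) C suc k) ^ 2 * suc (2 * k) ≤ 2 ^ 2 * (2 ^ (2 * k)) ^ 2
[2k+1]C[k+1]-bound k = begin
  d ^ 2 * suc (2 * k)       ≤⟨ *-monoˡ-≤ (suc (2 * k)) (^-monoˡ-≤ 2 d≤2c) ⟩
  (2 * c) ^ 2 * suc (2 * k) ≡⟨ regroup c (suc (2 * k)) ⟩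
  4 * (c ^ 2 * suc (2 * k)) ≤⟨ *-monoʳ-≤ 4 (central-binomial-bound k) ⟩
  4 * 16 ^ k                ≡⟨ cong (4 *_) (16^k≡[2^[2k]]^2 k) ⟩
  2 ^ 2 * (2 ^ (2 * k)) ^ 2 ∎
  where
  open ≤-Reasoning
  c = 2 * k C k
  d = suc (2 * k) C suc k
  regroup : ∀ x s → (2 * x) * ((2 * x) * 1) * s ≡ 4 * (x * (x * 1) * s)
  regroup = solve-∀
  double : ∀ k x → suc (suc (2 * k)) * x ≡ suc k * (2 * x)
  double = solve-∀
  d≤2c : d ≤ 2 * c
  d≤2c = *-cancelˡ-≤ (suc k) (begin
    suc k * d             ≡⟨ [k+1]*[n+1]C[k+1]≡[n+1]*nCk (2 * k) k ⟩
    suc (2 * k) * c       ≤⟨ *-monoˡ-≤ c (n≤1+n (suc (2 * k))) ⟩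
    suc (suc (2 * k)) * c ≡⟨ double k c ⟩
    suc k * (2 * c)       ∎)

blockingPairs : ∀ k → List (Vertex (suc (2 * k)))
blockingPairs k = List.map (false ∷_) (filter (∁? (balanced? k)) (vertices (2 * k)))

blockingPairs-unique : ∀ k → Unique (blockingPairs k)
blockingPairs-unique k = map⁺ ∷-injectiveʳ (filter⁺ (∁? (balanced? k)) (vertices-unique (2 * k)))

∈-blockingPairs⇔ : ∀ k u → u ∈ blockingPairs k ⇔ (head u ≡ false × Blocking u)
∈-blockingPairs⇔ k (b ∷ v) = mk⇔ to from
  where
  to : b ∷ v ∈ blockingPairs k → b ≡ false × Blocking (b ∷ v)
  to bv∈ with ∈-map⁻ (false ∷_) bv∈
  ... | _ , v∈ , refl = refl , ¬balanced⇒blocking {k} (proj₂ (∈-filter⁻ (∁? (balanced? k)) {xs = vertices (2 * k)} v∈))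
  from : b ≡ false × Blocking (b ∷ v) → b ∷ v ∈ blockingPairs k
  from (refl , blocking) =
    ∈-map⁺ (false ∷_) (∈-filter⁺ (∁? (balanced? k)) (∈-vertices v) (λ balanced → balanced⇒¬blocking balanced blocking))

nonBlocking+blocking : ∀ k → suc (2 * k) C suc k + length (blockingPairs k) ≡ 2 ^ (2 * k)
nonBlocking+blocking k = begin
  suc (2 * k) C suc k + length (blockingPairs k)
    ≡⟨ cong₂ _+_ (sym (length-filter-balanced k)) (length-map (false ∷_) (filter (∁? (balanced? k)) V)) ⟩
  length (filter (balanced? k) V) + length (filter (∁? (balanced? k)) V)
    ≡⟨ length-filter+length-filter-∁ (balanced? k) V ⟩
  length V
    ≡⟨ length-vertices (2 * k) ⟩
  2 ^ (2 * k) ∎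
  where
  open ≡-Reasoning
  V = vertices (2 * k)

lemma3 : ∃[ C ] ∀ (k : ℕ) →
    Σ (List (Vertex (suc (2 * k)))) λ S →
      Unique S
      × (∀ u → (u ∈ S) ⇔ ((head u ≡ false) × Blocking u))
      × length S ≤ 2 ^ (2 * k)
      × ((2 ^ (2 * k) ∸ length S) ^ 2) * suc (2 * k) ≤ (C ^ 2) * (2 ^ (2 * k)) ^ 2
lemma3 = 2 , λ k →
  blockingPairs k , blockingPairs-unique k , ∈-blockingPairs⇔ k ,
  subst (length (blockingPairs k) ≤_) (nonBlocking+blocking k) (m≤n+m _ _) ,
  subst (λ d → d ^ 2 * suc (2 * k) ≤ 2 ^ 2 * (2 ^ (2 * k)) ^ 2)
    (sym (nonBlocking-count k)) ([2k+1]C[k+1]-bound k)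
  where
  nonBlocking-count : ∀ k → 2 ^ (2 * k) ∸ length (blockingPairs k) ≡ suc (2 * k) C suc k
  nonBlocking-count k =
    trans (cong (_∸ length (blockingPairs k)) (sym (nonBlocking+blocking k))) (m+n∸n≡m (suc (2 * k) C suc k) (length (blockingPairs k)))
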